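{- Let $(\psi_n)_{n\ge 0}$ be a sequence of nonzero complex numbers, written $n_\psi:=\psi_n$, with $1_\psi=1$. Put $0_\psi!=1$, $n_\psi!=n_\psi\,(n-1)_\psi!$ for $n\ge1$. On the space $\mathbb{C}[x]$ of complex polynomials define the linear operators: the $\psi$-derivative $\partial_\psi x^n=n_\psi x^{n-1}$ for $n\ge1$, $\partial_\psi 1=0$; the $\psi$-integration $\int_\psi x^n=\frac{1}{(n+1)_\psi}x^{n+1}$ for $n\ge 0$; the generalized translation $E^{1}(\partial_\psi)=\sum_{k\ge0}\frac{1}{k_\psi!}\partial_\psi^k$; and the $\psi$-difference operator $\Delta_\psi=E^{1}(\partial_\psi)-\mathrm{id}$. Let the $\psi$-Bernoulli–Ward numbers $(B_n)_{n\ge0}$ be defined by the formal power series identity $$\sum_{n\ge0}\frac{B_n}{n_\psi!}z^n=\frac{z}{\exp_\psi(z)-1},\qquad \exp_\psi(z)=\sum_{n\ge0}\frac{z^n}{n_\psi!}.$$ Let $\varphi\in\mathbb{C}[x]$ and write $\varphi^{(0)}=\varphi$, $\varphi^{(n)}=\partial_\psi\varphi^{(n-1)}$. Then a polynomial $f$ satisfies $\Delta_\psi f=\varphi$ if and only if $$f(x)=\sum_{n\ge1}\frac{B_n}{n_\psi!}\varphi^{(n-1)}(x)+\int_\psi\varphi(x)+p(x)$$ for some polynomial $p$ with $\Delta_\psi p=0$ (i.e. $p(x+_\psi 1)=p(x)$, where $p(x+_\psi1):=(E^{1}(\partial_\psi)p)(x)$).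
   Context: For polynomials $\varphi$ the sum over $n$ is finite since $\partial_\psi$ lowers degree. The generalized translation satisfies $E^{a}(\partial_\psi)x^n=(x+_\psi a)^n:=\sum_{k}\binom{n}{k}_\psi a^k x^{n-k}$ with $\binom{n}{k}_\psi=\frac{n_\psi!}{k_\psi!(n-k)_\psi!}$. Standard examples: $n_\psi=\frac{1-q^n}{1-q}$ ($q$-calculus, $\partial_\psi$ the Jackson derivative) or $n_\psi=F_n$ (Fibonacci numbers). -}

module Defs where

open import Level using (Level; _⊔_)
open import Data.Nat using (ℕ; zero; suc; _≤_; _∸_)
open import Data.Product using (Σ; _×_; _,_)
open import Relation.Nullary using (¬_)
open import Algebra.Bundles using (CommutativeRing)

record Field (c ℓ : Level) : Set (Level.suc (c ⊔ ℓ)) where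
  field
    commRing : CommutativeRing c ℓ
  open CommutativeRing commRing public
  field
    inv      : Carrier → Carrier
    inv-law  : ∀ x → ¬ (x ≈ 0#) → x * inv x ≈ 1#
    1≉0      : ¬ (1# ≈ 0#)

module Psi {c ℓ : Level} (F : Field c ℓ) (ψ : ℕ → Field.Carrier F) where
  open Field F

  sumTo : ℕ → (ℕ → Carrier) → Carrier
  sumTo zero    f = 0#
  sumTo (suc n) f = sumTo n f + f n

  fact : ℕ → Carrier
  fact zero    = 1#
  fact (suc n) = ψ (suc n) * fact n

  invFact : ℕ → Carrier
  invFact n = inv (fact n)

  -- Sequences of coefficients (formal power series / polynomials):
  -- f n is the coefficient of x^n (resp. z^n).
  Seq : Set c
  Seq = ℕ → Carrier

  _≐_ : Seq → Seq → Set ℓ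
  f ≐ g = ∀ n → f n ≈ g n

  record Poly : Set (c ⊔ ℓ) where
    field
      coeff  : Seq
      bound  : ℕ
      vanish : ∀ n → bound ≤ n → coeff n ≈ 0#
  open Poly public

  zeroSeq : Seq
  zeroSeq _ = 0#

  ∂ : Seq → Seq
  ∂ f n = ψ (suc n) * f (suc n)

  ∂^ : ℕ → Seq → Seq
  ∂^ zero    f = f
  ∂^ (suc k) f = ∂ (∂^ k f)

  ∫ψ : Seq → Seq
  ∫ψ f zero    = 0#
  ∫ψ f (suc n) = inv (ψ (suc n)) * f n

  -- Generalized translation E¹(∂_ψ) = Σ_k (1/k_ψ!) ∂_ψ^k on a polynomial;
  -- the sum is finite: ∂_ψ^k p = 0 for k ≥ bound p, so summing k ≤ bound p
  -- gives the full sum.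
  E¹ : Poly → Seq
  E¹ p n = sumTo (suc (bound p)) (λ k → invFact k * ∂^ k (coeff p) n)

  Δψ : Poly → Seq
  Δψ p n = E¹ p n - coeff p n

  _⋆_ : Seq → Seq → Seq
  (a ⋆ b) n = sumTo (suc n) (λ i → a i * b (n ∸ i))

  expψ : Seq
  expψ n = invFact n

  expψ-1 : Seq
  expψ-1 zero    = 0#
  expψ-1 (suc n) = expψ (suc n)

  zSeries : Seq
  zSeries zero          = 0#
  zSeries (suc zero)    = 1#
  zSeries (suc (suc n)) = 0#

  -- B is the sequence of ψ-Bernoulli–Ward numbers:
  --   (Σ_n B_n/n_ψ! z^n) · (exp_ψ(z) − 1) = z   as formal power series
  -- (equivalent to the stated identity with z/(exp_ψ(z) − 1)).
  IsBernoulliWard : Seq → Set ℓ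
  IsBernoulliWard B = ((λ n → B n * invFact n) ⋆ expψ-1) ≐ zSeries

  -- Σ_{n≥1} (B_n/n_ψ!) φ^{(n-1)}; finite since φ^{(n-1)} = 0 for n-1 ≥ bound φ.
  bernoulliPart : Seq → Poly → Seq
  bernoulliPart B φ m =
    sumTo (suc (bound φ)) (λ j → (B (suc j) * invFact (suc j)) * ∂^ j (coeff φ) m)

  _⊕_ : Seq → Seq → Seq
  (f ⊕ g) n = f n + g n

-- With c_j = B_j/j_ψ! and Φ = ∫_ψ φ, the proposed particular solution is
-- G = Σ_j c_j ∂_ψ^j Φ (its j = 0 term is Φ because c_0 = 1, and ∂_ψ^(j+1) Φ = ∂_ψ^j φ).
-- As Δ_ψ = Σ_{k≥1} (1/k_ψ!) ∂_ψ^k, collecting terms by s = j + k gives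
-- Δ_ψ G = Σ_s (c ⋆ (exp_ψ − 1))_s ∂_ψ^s Φ = ∂_ψ Φ = φ, since the defining identity of the
-- B_n says c ⋆ (exp_ψ − 1) = z. Δ_ψ is additive, so Δ_ψ f = φ iff Δ_ψ (f − G) = 0.

module Submission where

open import Defs
open import Level using (Level)
open import Data.Nat using (ℕ; zero; suc; _≤_; _<_; _≤′_; ≤′-refl; ≤′-step; _∸_; s≤s)
  renaming (_+_ to _+ℕ_)
import Data.Nat.Properties as ℕ
open import Data.Product using (Σ; _×_; _,_)
open import Relation.Nullary using (¬_)
open import Relation.Binary.PropositionalEquality as ≡ using (_≡_)
open import Function.Bundles using (_⇔_; mk⇔)
import Algebra.Properties.AbelianGroup as AbelianGroupProperties
import Algebra.Properties.CommutativeSemigroup as CommutativeSemigroupProperties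
import Relation.Binary.Reasoning.Setoid as SetoidReasoning

m∸n≤o⇒m≤o+n : ∀ m n {o} → m ∸ n ≤ o → m ≤ o +ℕ n
m∸n≤o⇒m≤o+n m n {o} m∸n≤o = begin
  m             ≤⟨ ℕ.m≤n+m∸n m n ⟩
  n +ℕ (m ∸ n)  ≤⟨ ℕ.+-monoʳ-≤ n m∸n≤o ⟩
  n +ℕ o        ≡⟨ ℕ.+-comm n o ⟩
  o +ℕ n        ∎
  where open ℕ.≤-Reasoning

module DifferenceEquation {c ℓ : Level} (F : Field c ℓ) (ψ : ℕ → Field.Carrier F) where
  open Field F
  open Psi F ψ
  open SetoidReasoning setoid
  open AbelianGroupProperties +-abelianGroup using (xyx⁻¹≈y; x≈y⇒x∙y⁻¹≈ε; ⁻¹-∙-comm)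
  open CommutativeSemigroupProperties +-commutativeSemigroup using (interchange)
  open CommutativeSemigroupProperties *-commutativeSemigroup using (x∙yz≈y∙xz)

  y≈0⇒x*y≈0 : ∀ {x y} → y ≈ 0# → x * y ≈ 0#
  y≈0⇒x*y≈0 {x} y≈0 = trans (*-cong refl y≈0) (zeroʳ x)

  x≈1⇒inv[x]≈1 : ∀ {x} → x ≈ 1# → inv x ≈ 1#
  x≈1⇒inv[x]≈1 {x} x≈1 = begin
    inv x       ≈⟨ *-identityˡ _ ⟨
    1# * inv x  ≈⟨ *-cong x≈1 refl ⟨
    x * inv x   ≈⟨ inv-law x (λ x≈0 → 1≉0 (trans (sym x≈1) x≈0)) ⟩
    1#          ∎

  sumTo-cong< : ∀ n {f g : Seq} → (∀ {k} → k < n → f k ≈ g k) → sumTo n f ≈ sumTo n g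
  sumTo-cong< zero    f≈g = refl
  sumTo-cong< (suc n) f≈g =
    +-cong (sumTo-cong< n (λ k<n → f≈g (ℕ.m<n⇒m<1+n k<n))) (f≈g (ℕ.n<1+n n))

  sumTo-cong : ∀ n {f g : Seq} → f ≐ g → sumTo n f ≈ sumTo n g
  sumTo-cong n f≐g = sumTo-cong< n (λ {k} _ → f≐g k)

  sumTo-zero : ∀ n {f : Seq} → (∀ {k} → k < n → f k ≈ 0#) → sumTo n f ≈ 0#
  sumTo-zero zero    f≈0 = refl
  sumTo-zero (suc n) f≈0 = trans
    (+-cong (sumTo-zero n (λ k<n → f≈0 (ℕ.m<n⇒m<1+n k<n))) (f≈0 (ℕ.n<1+n n)))
    (+-identityʳ 0#)

  sumTo-distrib-+ : ∀ n (f g : Seq) → sumTo n (f ⊕ g) ≈ sumTo n f + sumTo n g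
  sumTo-distrib-+ zero    f g = sym (+-identityʳ 0#)
  sumTo-distrib-+ (suc n) f g = trans (+-cong (sumTo-distrib-+ n f g) refl) (interchange _ _ _ _)

  *-distribˡ-sumTo : ∀ n a (f : Seq) → a * sumTo n f ≈ sumTo n (λ k → a * f k)
  *-distribˡ-sumTo zero    a f = zeroʳ a
  *-distribˡ-sumTo (suc n) a f = trans (distribˡ a _ _) (+-cong (*-distribˡ-sumTo n a f) refl)

  *-distribʳ-sumTo : ∀ n a (f : Seq) → sumTo n f * a ≈ sumTo n (λ k → f k * a)
  *-distribʳ-sumTo n a f =
    trans (*-comm _ _) (trans (*-distribˡ-sumTo n a f) (sumTo-cong n (λ k → *-comm _ _)))

  sumTo-trim : ∀ {n m} (f : Seq) → n ≤ m → (∀ k → n ≤ k → f k ≈ 0#) → sumTo m f ≈ sumTo n f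
  sumTo-trim {n} f n≤m f≈0 = go (ℕ.≤⇒≤′ n≤m)
    where
    go : ∀ {m} → n ≤′ m → sumTo m f ≈ sumTo n f
    go ≤′-refl            = refl
    go (≤′-step {m} n≤′m) = trans (+-cong (go n≤′m) (f≈0 m (ℕ.≤′⇒≤ n≤′m))) (+-identityʳ _)

  sumTo-head : ∀ n (f : Seq) → sumTo (suc n) f ≈ f 0 + sumTo n (λ k → f (suc k))
  sumTo-head zero    f = +-comm _ _
  sumTo-head (suc n) f = trans (+-cong (sumTo-head n f) refl) (+-assoc _ _ _)

  sumTo-comm : ∀ m n (G : ℕ → ℕ → Carrier) →
    sumTo m (λ i → sumTo n (G i)) ≈ sumTo n (λ j → sumTo m (λ i → G i j))
  sumTo-comm zero    n G = sym (sumTo-zero n (λ _ → refl))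
  sumTo-comm (suc m) n G =
    trans (+-cong (sumTo-comm m n G) refl) (sym (sumTo-distrib-+ n _ (G m)))

  sumTo-antidiagonal : ∀ L (G : ℕ → ℕ → Carrier) →
    sumTo L (λ i → sumTo (L ∸ i) (G i)) ≈ sumTo L (λ s → sumTo (suc s) (λ i → G i (s ∸ i)))
  sumTo-antidiagonal zero    G = refl
  sumTo-antidiagonal (suc L) G = begin
    sumTo L (λ i → sumTo (suc L ∸ i) (G i)) + sumTo (suc L ∸ L) (G L)
      ≈⟨ +-cong (sumTo-cong< L peel) corner ⟩
    sumTo L (λ i → sumTo (L ∸ i) (G i) + G i (L ∸ i)) + G L (L ∸ L)
      ≈⟨ +-cong (sumTo-distrib-+ L _ _) refl ⟩
    (sumTo L (λ i → sumTo (L ∸ i) (G i)) + sumTo L (λ i → G i (L ∸ i))) + G L (L ∸ L)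
      ≈⟨ +-assoc _ _ _ ⟩
    sumTo L (λ i → sumTo (L ∸ i) (G i)) + sumTo (suc L) (λ i → G i (L ∸ i))
      ≈⟨ +-cong (sumTo-antidiagonal L G) refl ⟩
    sumTo L (λ s → sumTo (suc s) (λ i → G i (s ∸ i))) + sumTo (suc L) (λ i → G i (L ∸ i)) ∎
    where
    peel : ∀ {i} → i < L → sumTo (suc L ∸ i) (G i) ≈ sumTo (L ∸ i) (G i) + G i (L ∸ i)
    peel {i} i<L = reflexive (≡.cong (λ t → sumTo t (G i)) (ℕ.+-∸-assoc 1 (ℕ.<⇒≤ i<L)))
    corner : sumTo (suc L ∸ L) (G L) ≈ G L (L ∸ L)
    corner rewrite ℕ.m+n∸n≡m 1 L | ℕ.n∸n≡0 L = +-identityˡ _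

  sumTo-⋆ : ∀ L (a b X : Seq) → (∀ s → L ≤ s → X s ≈ 0#) →
    sumTo L (λ k → b k * sumTo L (λ j → a j * X (k +ℕ j))) ≈ sumTo L (λ s → (a ⋆ b) s * X s)
  sumTo-⋆ L a b X X≈0 = begin
    sumTo L (λ k → b k * sumTo L (λ j → a j * X (k +ℕ j)))
      ≈⟨ sumTo-cong L (λ k → *-distribˡ-sumTo L (b k) _) ⟩
    sumTo L (λ k → sumTo L (λ j → b k * (a j * X (k +ℕ j))))
      ≈⟨ sumTo-comm L L _ ⟩
    sumTo L (λ j → sumTo L (λ k → b k * (a j * X (k +ℕ j))))
      ≈⟨ sumTo-cong L (λ j → sumTo-cong L (λ k → trans (x∙yz≈y∙xz _ _ _) (sym (*-assoc _ _ _)))) ⟩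
    sumTo L (λ j → sumTo L (G j))
      ≈⟨ sumTo-cong L (λ j → sumTo-trim (G j) (ℕ.m∸n≤m L j) (λ k → G-vanish j k)) ⟩
    sumTo L (λ j → sumTo (L ∸ j) (G j))
      ≈⟨ sumTo-antidiagonal L G ⟩
    sumTo L (λ s → sumTo (suc s) (λ j → G j (s ∸ j)))
      ≈⟨ sumTo-cong L (λ s → sym (coefficient s)) ⟩
    sumTo L (λ s → (a ⋆ b) s * X s) ∎
    where
    G : ℕ → ℕ → Carrier
    G j k = (a j * b k) * X (k +ℕ j)
    G-vanish : ∀ j k → L ∸ j ≤ k → G j k ≈ 0#
    G-vanish j k L∸j≤k = y≈0⇒x*y≈0 (X≈0 (k +ℕ j) (m∸n≤o⇒m≤o+n L j L∸j≤k))
    coefficient : ∀ s → (a ⋆ b) s * X s ≈ sumTo (suc s) (λ j → G j (s ∸ j))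
    coefficient s = trans (*-distribʳ-sumTo (suc s) (X s) _) (sumTo-cong< (suc s) (λ j<1+s →
      *-cong refl (reflexive (≡.cong X (≡.sym (ℕ.m∸n+n≡m (ℕ.≤-pred j<1+s)))))))

  sumTo-zSeries : ∀ L (Z : Seq) → sumTo (suc (suc L)) (λ s → zSeries s * Z s) ≈ Z 1
  sumTo-zSeries zero    Z = begin
    (0# + 0# * Z 0) + 1# * Z 1  ≈⟨ +-cong (trans (+-identityˡ _) (zeroˡ _)) (*-identityˡ _) ⟩
    0# + Z 1                    ≈⟨ +-identityˡ _ ⟩
    Z 1                         ∎
  sumTo-zSeries (suc L) Z = trans (+-cong (sumTo-zSeries L Z) (zeroˡ _)) (+-identityʳ _)

  ∂^-cong : ∀ k {f g : Seq} → f ≐ g → ∂^ k f ≐ ∂^ k g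
  ∂^-cong zero    f≐g = f≐g
  ∂^-cong (suc k) f≐g n = *-cong refl (∂^-cong k f≐g (suc n))

  ∂^-vanish : ∀ k {f : Seq} {N} → (∀ n → N ≤ n → f n ≈ 0#) → ∀ n → N ≤ k +ℕ n → ∂^ k f n ≈ 0#
  ∂^-vanish zero    f≈0 n N≤n   = f≈0 n N≤n
  ∂^-vanish (suc k) {N = N} f≈0 n N≤k+n =
    y≈0⇒x*y≈0 (∂^-vanish k f≈0 (suc n) (≡.subst (N ≤_) (≡.sym (ℕ.+-suc k n)) N≤k+n))

  ∂^-⊕ : ∀ k (f g : Seq) → ∂^ k (f ⊕ g) ≐ (∂^ k f ⊕ ∂^ k g)
  ∂^-⊕ zero    f g n = refl
  ∂^-⊕ (suc k) f g n = trans (*-cong refl (∂^-⊕ k f g (suc n))) (distribˡ _ _ _)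

  ∂^-sumTo : ∀ k J (a : Seq) (h : ℕ → Seq) →
    ∂^ k (λ m → sumTo J (λ j → a j * h j m)) ≐ (λ n → sumTo J (λ j → a j * ∂^ k (h j) n))
  ∂^-sumTo zero    J a h n = refl
  ∂^-sumTo (suc k) J a h n = trans (*-cong refl (∂^-sumTo k J a h (suc n)))
    (trans (*-distribˡ-sumTo J _ _) (sumTo-cong J (λ j → x∙yz≈y∙xz _ _ _)))

  ∂^-∂^ : ∀ k j (f : Seq) → ∂^ k (∂^ j f) ≡ ∂^ (k +ℕ j) f
  ∂^-∂^ zero    j f = ≡.refl
  ∂^-∂^ (suc k) j f = ≡.cong ∂ (∂^-∂^ k j f)

  ∫ψ-vanish : ∀ {f : Seq} {N} → (∀ n → N ≤ n → f n ≈ 0#) → ∀ n → suc N ≤ n → ∫ψ f n ≈ 0#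
  ∫ψ-vanish f≈0 (suc n) (s≤s N≤n) = y≈0⇒x*y≈0 (f≈0 n N≤n)

  module _ (ψ≉0 : ∀ n → ¬ (ψ (suc n) ≈ 0#)) where

    ∂-∫ψ : ∀ (f : Seq) → ∂ (∫ψ f) ≐ f
    ∂-∫ψ f n = begin
      ψ (suc n) * (inv (ψ (suc n)) * f n)  ≈⟨ *-assoc _ _ _ ⟨
      (ψ (suc n) * inv (ψ (suc n))) * f n  ≈⟨ *-cong (inv-law _ (ψ≉0 n)) refl ⟩
      1# * f n                             ≈⟨ *-identityˡ _ ⟩
      f n                                  ∎

    ∂^-∫ψ : ∀ k (f : Seq) → ∂^ (suc k) (∫ψ f) ≐ ∂^ k f
    ∂^-∫ψ zero    f n = ∂-∫ψ f n
    ∂^-∫ψ (suc k) f n = *-cong refl (∂^-∫ψ k f (suc n))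

  -- Δ_ψ with the series E¹(∂_ψ) cut off after order K; Δψ p is Δ[ bound p ] (coeff p).
  Δ[_] : ℕ → Seq → Seq
  Δ[ K ] h n = sumTo (suc K) (λ k → invFact k * ∂^ k h n) - h n

  Δ[]-cong : ∀ K {h h' : Seq} → h ≐ h' → Δ[ K ] h ≐ Δ[ K ] h'
  Δ[]-cong K h≐h' n =
    +-cong (sumTo-cong (suc K) (λ k → *-cong refl (∂^-cong k h≐h' n))) (-‿cong (h≐h' n))

  Δ[]-trim : ∀ {K M} (h : Seq) → K ≤ M → (∀ n → K ≤ n → h n ≈ 0#) → Δ[ M ] h ≐ Δ[ K ] h
  Δ[]-trim {K} h K≤M h≈0 n = +-cong (sumTo-trim _ (s≤s K≤M) high-order-vanish) refl
    where
    high-order-vanish : ∀ k → K < k → invFact k * ∂^ k h n ≈ 0#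
    high-order-vanish k K<k =
      y≈0⇒x*y≈0 (∂^-vanish k h≈0 n (ℕ.≤-trans (ℕ.<⇒≤ K<k) (ℕ.m≤m+n k n)))

  Δ[]-⊕ : ∀ K (h h' : Seq) → Δ[ K ] (h ⊕ h') ≐ (Δ[ K ] h ⊕ Δ[ K ] h')
  Δ[]-⊕ K h h' n = begin
    sumTo (suc K) (λ k → invFact k * ∂^ k (h ⊕ h') n) - (h n + h' n)
      ≈⟨ +-cong (sumTo-cong (suc K) (λ k → trans (*-cong refl (∂^-⊕ k h h' n)) (distribˡ _ _ _)))
                (sym (⁻¹-∙-comm _ _)) ⟩
    sumTo (suc K) (λ k → invFact k * ∂^ k h n + invFact k * ∂^ k h' n) + (- h n + - h' n)
      ≈⟨ +-cong (sumTo-distrib-+ (suc K) _ _) refl ⟩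
    (sumTo (suc K) (λ k → invFact k * ∂^ k h n) + sumTo (suc K) (λ k → invFact k * ∂^ k h' n))
      + (- h n + - h' n)
      ≈⟨ interchange _ _ _ _ ⟩
    Δ[ K ] h n + Δ[ K ] h' n ∎

  Δ[]≈sumTo-expψ-1 : ∀ K (h : Seq) n → Δ[ K ] h n ≈ sumTo (suc K) (λ k → expψ-1 k * ∂^ k h n)
  Δ[]≈sumTo-expψ-1 K h n = begin
    sumTo (suc K) (λ k → invFact k * ∂^ k h n) - h n
      ≈⟨ +-cong (sumTo-head K _) refl ⟩
    (invFact 0 * h n + S) - h n
      ≈⟨ +-cong (+-cong (trans (*-cong (x≈1⇒inv[x]≈1 refl) refl) (*-identityˡ _)) refl) refl ⟩
    (h n + S) - h n
      ≈⟨ xyx⁻¹≈y _ _ ⟩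
    S
      ≈⟨ trans (+-cong (zeroˡ _) refl) (+-identityˡ _) ⟨
    0# * h n + S
      ≈⟨ sumTo-head K _ ⟨
    sumTo (suc K) (λ k → expψ-1 k * ∂^ k h n) ∎
    where
    S : Carrier
    S = sumTo K (λ k → invFact (suc k) * ∂^ (suc k) h n)

  Δψ≐Δ[] : ∀ {M} (p : Poly) → bound p ≤ M → Δψ p ≐ Δ[ M ] (coeff p)
  Δψ≐Δ[] p bound≤M n = sym (Δ[]-trim (coeff p) bound≤M (vanish p) n)

  Δψ-⊕ : (f g h : Poly) → coeff f ≐ (coeff g ⊕ coeff h) → Δψ f ≐ (Δψ g ⊕ Δψ h)
  Δψ-⊕ f g h f≐g⊕h n = begin
    Δψ f n                           ≈⟨ Δψ≐Δ[] f (ℕ.≤-trans (ℕ.m≤m+n _ _) (ℕ.m≤m+n _ _)) n ⟩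
    Δ[ M ] (coeff f) n               ≈⟨ Δ[]-cong M f≐g⊕h n ⟩
    Δ[ M ] (coeff g ⊕ coeff h) n     ≈⟨ Δ[]-⊕ M (coeff g) (coeff h) n ⟩
    Δ[ M ] (coeff g) n + Δ[ M ] (coeff h) n
      ≈⟨ +-cong (Δψ≐Δ[] g (ℕ.≤-trans (ℕ.m≤n+m _ (bound f)) (ℕ.m≤m+n _ _)) n)
                (Δψ≐Δ[] h (ℕ.m≤n+m _ (bound f +ℕ bound g)) n) ⟨
    Δψ g n + Δψ h n ∎
    where
    M : ℕ
    M = bound f +ℕ bound g +ℕ bound h

  _⊖_ : Poly → Poly → Poly
  f ⊖ g = record
    { coeff  = λ n → coeff f n - coeff g n
    ; bound  = bound f +ℕ bound g
    ; vanish = λ n f+g≤n → x≈y⇒x∙y⁻¹≈ε (trans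
        (vanish f n (ℕ.≤-trans (ℕ.m≤m+n _ _) f+g≤n))
        (sym (vanish g n (ℕ.≤-trans (ℕ.m≤n+m _ _) f+g≤n))))
    }

  f≐g⊕[f⊖g] : (f g : Poly) → coeff f ≐ (coeff g ⊕ coeff (f ⊖ g))
  f≐g⊕[f⊖g] f g n = sym (trans (sym (+-assoc _ _ _)) (xyx⁻¹≈y (coeff g n) (coeff f n)))

  bernoulliCoeff : Seq → Seq
  bernoulliCoeff B n = B n * invFact n

  -- A truncation of the operator ∂_ψ/(E¹(∂_ψ) − id) = Σ_j (B_j/j_ψ!) ∂_ψ^j.
  bernoulliOperator : Seq → ℕ → Seq → Seq
  bernoulliOperator B L Φ m = sumTo L (λ j → bernoulliCoeff B j * ∂^ j Φ m)

  Δ[]-bernoulliOperator : ∀ {B} → IsBernoulliWard B → ∀ N (Φ : Seq) → (∀ n → suc N ≤ n → Φ n ≈ 0#) →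
    Δ[ suc N ] (bernoulliOperator B (suc (suc N)) Φ) ≐ ∂ Φ
  Δ[]-bernoulliOperator {B} bw N Φ Φ≈0 n = begin
    Δ[ suc N ] (bernoulliOperator B L Φ) n
      ≈⟨ Δ[]≈sumTo-expψ-1 (suc N) _ n ⟩
    sumTo L (λ k → expψ-1 k * ∂^ k (bernoulliOperator B L Φ) n)
      ≈⟨ sumTo-cong L (λ k → *-cong refl (∂^-bernoulliOperator k)) ⟩
    sumTo L (λ k → expψ-1 k * sumTo L (λ j → bernoulliCoeff B j * ∂^ (k +ℕ j) Φ n))
      ≈⟨ sumTo-⋆ L (bernoulliCoeff B) expψ-1 (λ s → ∂^ s Φ n) ∂^Φ-vanish ⟩
    sumTo L (λ s → (bernoulliCoeff B ⋆ expψ-1) s * ∂^ s Φ n)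
      ≈⟨ sumTo-cong L (λ s → *-cong (bw s) refl) ⟩
    sumTo L (λ s → zSeries s * ∂^ s Φ n)
      ≈⟨ sumTo-zSeries N _ ⟩
    ∂ Φ n ∎
    where
    L : ℕ
    L = suc (suc N)
    ∂^-bernoulliOperator : ∀ k →
      ∂^ k (bernoulliOperator B L Φ) n ≈ sumTo L (λ j → bernoulliCoeff B j * ∂^ (k +ℕ j) Φ n)
    ∂^-bernoulliOperator k = trans (∂^-sumTo k L (bernoulliCoeff B) (λ j → ∂^ j Φ) n)
      (sumTo-cong L (λ j → reflexive (≡.cong (λ g → bernoulliCoeff B j * g n) (∂^-∂^ k j Φ))))
    ∂^Φ-vanish : ∀ s → L ≤ s → ∂^ s Φ n ≈ 0#
    ∂^Φ-vanish s L≤s = ∂^-vanish s Φ≈0 n (ℕ.≤-trans (ℕ.<⇒≤ L≤s) (ℕ.m≤m+n s n))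

  bernoulliCoeff₀ : ∀ {B} → IsBernoulliWard B → ψ 1 ≈ 1# → bernoulliCoeff B 0 ≈ 1#
  bernoulliCoeff₀ {B} bw ψ1≈1 = begin
    c₀
      ≈⟨ *-identityʳ _ ⟨
    c₀ * 1#
      ≈⟨ *-cong refl invFact1≈1 ⟨
    c₀ * invFact 1
      ≈⟨ trans (+-cong (+-identityˡ _) (zeroʳ _)) (+-identityʳ _) ⟨
    (0# + c₀ * invFact 1) + bernoulliCoeff B 1 * 0#
      ≈⟨ bw 1 ⟩
    1# ∎
    where
    c₀ : Carrier
    c₀ = bernoulliCoeff B 0
    invFact1≈1 : invFact 1 ≈ 1#
    invFact1≈1 = x≈1⇒inv[x]≈1 (trans (*-identityʳ _) ψ1≈1)

  bernoulliPart-vanish : ∀ B (φ : Poly) n → bound φ ≤ n → bernoulliPart B φ n ≈ 0#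
  bernoulliPart-vanish B φ n N≤n = sumTo-zero (suc (bound φ)) (λ {j} _ →
    y≈0⇒x*y≈0 (∂^-vanish j (vanish φ) n (ℕ.≤-trans N≤n (ℕ.m≤n+m n j))))

  particularSolution : Seq → Poly → Poly
  particularSolution B φ = record
    { coeff  = bernoulliPart B φ ⊕ ∫ψ (coeff φ)
    ; bound  = suc (bound φ)
    ; vanish = λ n N<n → trans
        (+-cong (bernoulliPart-vanish B φ n (ℕ.<⇒≤ N<n)) (∫ψ-vanish (vanish φ) n N<n))
        (+-identityʳ 0#)
    }

  module _ (ψ≉0 : ∀ n → ¬ (ψ (suc n) ≈ 0#)) (ψ1≈1 : ψ 1 ≈ 1#) {B : Seq} (bw : IsBernoulliWard B)
           (φ : Poly) where

    particularSolution≐bernoulliOperator :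
      coeff (particularSolution B φ) ≐ bernoulliOperator B (suc (suc (bound φ))) (∫ψ (coeff φ))
    particularSolution≐bernoulliOperator m = sym (begin
      bernoulliOperator B (suc (suc N)) Φ m
        ≈⟨ sumTo-head (suc N) _ ⟩
      bernoulliCoeff B 0 * Φ m + sumTo (suc N) (λ j → bernoulliCoeff B (suc j) * ∂^ (suc j) Φ m)
        ≈⟨ +-cong (trans (*-cong (bernoulliCoeff₀ bw ψ1≈1) refl) (*-identityˡ _))
                  (sumTo-cong (suc N) (λ j → *-cong refl (∂^-∫ψ ψ≉0 j (coeff φ) m))) ⟩
      Φ m + bernoulliPart B φ m
        ≈⟨ +-comm _ _ ⟩
      bernoulliPart B φ m + Φ m ∎)
      where
      N : ℕ
      N = bound φ
      Φ : Seq
      Φ = ∫ψ (coeff φ)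

    Δψ-particularSolution : Δψ (particularSolution B φ) ≐ coeff φ
    Δψ-particularSolution n = begin
      Δψ (particularSolution B φ) n
        ≈⟨ Δ[]-cong (suc (bound φ)) particularSolution≐bernoulliOperator n ⟩
      Δ[ suc (bound φ) ] (bernoulliOperator B (suc (suc (bound φ))) (∫ψ (coeff φ))) n
        ≈⟨ Δ[]-bernoulliOperator bw (bound φ) (∫ψ (coeff φ)) (∫ψ-vanish (vanish φ)) n ⟩
      ∂ (∫ψ (coeff φ)) n
        ≈⟨ ∂-∫ψ ψ≉0 (coeff φ) n ⟩
      coeff φ n ∎

mainTheorem1 : ∀ {c ℓ : Level} (F : Field c ℓ) (ψ : ℕ → Field.Carrier F) →
    (∀ n → ¬ (Field._≈_ F (ψ n) (Field.0# F))) →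
    Field._≈_ F (ψ 1) (Field.1# F) →
    (B : ℕ → Field.Carrier F) → Psi.IsBernoulliWard F ψ B →
    (φ f : Psi.Poly F ψ) →
    Psi._≐_ F ψ (Psi.Δψ F ψ f) (Psi.coeff φ)
    ⇔
    Σ (Psi.Poly F ψ) (λ p →
        Psi._≐_ F ψ (Psi.Δψ F ψ p) (Psi.zeroSeq F ψ)
      × Psi._≐_ F ψ (Psi.coeff f)
          (Psi._⊕_ F ψ (Psi._⊕_ F ψ (Psi.bernoulliPart F ψ B φ) (Psi.∫ψ F ψ (Psi.coeff φ)))
            (Psi.coeff p)))
mainTheorem1 F ψ ψ≉0 ψ1≈1 B bw φ f = mk⇔ to from
  where
  open Field F
  open Psi F ψ
  open DifferenceEquation F ψ
  open SetoidReasoning setoid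
  open AbelianGroupProperties +-abelianGroup using (identityʳ-unique)

  G : Poly
  G = particularSolution B φ

  ΔG≐φ : Δψ G ≐ coeff φ
  ΔG≐φ = Δψ-particularSolution (λ n → ψ≉0 (suc n)) ψ1≈1 bw φ

  to : Δψ f ≐ coeff φ → Σ Poly (λ p → Δψ p ≐ zeroSeq × coeff f ≐ (coeff G ⊕ coeff p))
  to Δf≐φ = f ⊖ G , Δ[f⊖G]≐0 , f≐g⊕[f⊖g] f G
    where
    Δ[f⊖G]≐0 : Δψ (f ⊖ G) ≐ zeroSeq
    Δ[f⊖G]≐0 n = identityʳ-unique (coeff φ n) _ (begin
      coeff φ n + Δψ (f ⊖ G) n  ≈⟨ +-cong (ΔG≐φ n) refl ⟨
      Δψ G n + Δψ (f ⊖ G) n     ≈⟨ Δψ-⊕ f G (f ⊖ G) (f≐g⊕[f⊖g] f G) n ⟨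
      Δψ f n                    ≈⟨ Δf≐φ n ⟩
      coeff φ n                 ∎)

  from : Σ Poly (λ p → Δψ p ≐ zeroSeq × coeff f ≐ (coeff G ⊕ coeff p)) → Δψ f ≐ coeff φ
  from (p , Δp≐0 , f≐G⊕p) n = begin
    Δψ f n           ≈⟨ Δψ-⊕ f G p f≐G⊕p n ⟩
    Δψ G n + Δψ p n  ≈⟨ +-cong (ΔG≐φ n) (Δp≐0 n) ⟩
    coeff φ n + 0#   ≈⟨ +-identityʳ _ ⟩
    coeff φ n        ∎
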